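{- Let $T$ be a $\beta(1,0)$-tree having one of the structures (F0), (F1), (F2) below. Then $h(T)=T$. (F0) $T$ is the one-node tree. (F1) There is a $\beta(1,0)$-tree $A$ such that $T$ is obtained as follows: take $h(A)$, change the label of its root to $1$ (unless it is $1$ already), and attach the root of the result by a new edge as a new rightmost child of the root of $A$; finally set the root label equal to the sum of the labels of its children. (F2) There are a $\beta(1,0)$-tree $A_1$, an integer $b>1$, and a $\beta(1,0)$-tree $A_2$ with at least two nodes, $h(A_2)=A_2$ and $\mathrm{root}(A_2)\ge b-1$, such that $T$ is obtained as follows: attach (the root of) $h(A_1)$ by a new edge as a new rightmost child of the $(b-1)$-th node on the rightmost path of $A_2$ (nodes on this path counted from the root, the root being the first); in the rightmost path of the resulting tree, add $1$ to the label of every non-root node from the $(b-1)$-th node upwards (if any), and set the label of the $b$-th node (the root of the attached copy of $h(A_1)$) to $1$; change the root label to $b$, and call the result $A_2'$. Then attach the root of $A_2'$ by a new edge as a new rightmost child of the root of $A_1$, and set the root label equal to the sum of the labels of its children.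
   Context: A $\beta(1,0)$-tree is a rooted plane tree (the children of each node are linearly ordered from left to right) whose nodes are labeled with positive integers such that: leaves have label $1$; the root has label equal to the sum of its children's labels; every other node has label between $1$ and the sum of its children's labels. (The one-node tree consists of a single node with label $1$.) For a $\beta(1,0)$-tree $T$, $\mathrm{root}(T)$ is the label of the root, the rightmost path is the path from the root obtained by repeatedly passing to the rightmost child until reaching a leaf, and $\mathrm{rpath}(T)$ is its number of edges. The depth of a node is its distance from the root. The map $h$ on $\beta(1,0)$-trees is defined recursively (it is a well-defined map with $\mathrm{rpath}(h(A))=\mathrm{root}(A)$ for every $A$ with at least two nodes): (i) $h$ maps the one-node tree and the one-edge tree to themselves. (ii) If the root of $T$ has exactly one child $v$, $v$ has label $c$, and $v$ is not a leaf: let $A$ be the subtree rooted at $v$, with the label of $v$ replaced by the sum of the labels of its children. Then $h(T)$ is obtained from $h(A)$ by attaching a new leaf (label $1$) as the new rightmost child of the node at depth $c-1$ on the rightmost path of $h(A)$, and increasing by $1$ the labels of all nodes on the rightmost path above the new leaf (i.e. at depths $0,1,\dots,c-1$). (iii) If the root of $T$ has at least two children: let $A$ be the tree formed by the root and all its subtrees except the rightmost one, with root label equal to the sum of the labels of those children, and let $B$ be the tree formed by the root and its rightmost subtree, with root label equal to the label of the rightmost child. Then $h(T)$ is obtained by identifying the rightmost leaf of $h(B)$ with the root of $h(A)$, the identified node keeping label $1$. -}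

module Defs where

open import Data.Nat using (ℕ; zero; suc; _+_; _∸_; _≤_; _<_)
open import Data.List using (List; []; _∷_; _++_)
open import Data.List.Relation.Unary.All using (All)
open import Data.Product using (Σ; _×_; _,_)
open import Relation.Binary.PropositionalEquality using (_≡_)

-- Rooted plane trees with natural-number labels; children listed left to right.
data Tree : Set where
  node : ℕ → List Tree → Tree

label : Tree → ℕ
label (node l _) = l

root : Tree → ℕ
root = label

sumLabels : List Tree → ℕ
sumLabels [] = 0
sumLabels (t ∷ ts) = label t + sumLabels ts

size : Tree → ℕ
sizeList : List Tree → ℕ
size (node _ cs) = suc (sizeList cs)
sizeList [] = 0
sizeList (t ∷ ts) = size t + sizeList ts

setLabel : ℕ → Tree → Tree
setLabel k (node _ cs) = node k cs

leaf : Tree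
leaf = node 1 []

data NonRootOK : Tree → Set where
  leafOK  : NonRootOK (node 1 [])
  innerOK : ∀ {l c cs} → 1 ≤ l → l ≤ sumLabels (c ∷ cs) →
            All NonRootOK (c ∷ cs) → NonRootOK (node l (c ∷ cs))

data IsBeta : Tree → Set where
  single : IsBeta (node 1 [])
  rootOK : ∀ {l c cs} → l ≡ sumLabels (c ∷ cs) →
           All NonRootOK (c ∷ cs) → IsBeta (node l (c ∷ cs))

-- graft d s t : attach s as a new rightmost child of the node at depth d
-- on the rightmost path of t, adding 1 to the labels of the nodes at
-- depths 0,1,…,d of the rightmost path.
graft : ℕ → Tree → Tree → Tree
graftLast : ℕ → Tree → List Tree → List Tree
graft zero s (node l cs) = node (suc l) (cs ++ (s ∷ []))
graft (suc d) s (node l cs) = node (suc l) (graftLast d s cs)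
graftLast d s [] = []
graftLast d s (t ∷ []) = graft d s t ∷ []
graftLast d s (t ∷ ts@(_ ∷ _)) = t ∷ graftLast d s ts

-- replaceRL t s : identify the rightmost leaf of t with the root of s,
-- the identified node receiving label 1.
replaceRL : Tree → Tree → Tree
replaceRLList : List Tree → Tree → List Tree
replaceRL (node l []) s = setLabel 1 s
replaceRL (node l cs@(_ ∷ _)) s = node l (replaceRLList cs s)
replaceRLList [] s = []
replaceRLList (t ∷ []) s = replaceRL t s ∷ []
replaceRLList (t ∷ ts@(_ ∷ _)) s = t ∷ replaceRLList ts s

splitLast : Tree → List Tree → List Tree × Tree
splitLast x [] = [] , x
splitLast x (y ∷ ys) with splitLast y ys
... | (i , z) = (x ∷ i) , z

-- The map h, defined by the recursion (i)-(iii), with a fuel argument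
-- (fuel = number of nodes suffices, since every recursive call is on a
-- tree with strictly fewer nodes).  The root label of the argument is
-- never inspected except in the base cases (i).

hF : ℕ → Tree → Tree
hF zero t = t
hF (suc n) (node l []) = node l []
hF (suc n) (node l (node m [] ∷ [])) = node l (node m [] ∷ [])
hF (suc n) (node l (node c (d ∷ ds) ∷ [])) =
  graft (c ∸ 1) leaf (hF n (node (sumLabels (d ∷ ds)) (d ∷ ds)))
hF (suc n) (node l (x ∷ y ∷ ys)) with splitLast x (y ∷ ys)
... | (ini , lst) =
  replaceRL (hF n (node (label lst) (lst ∷ [])))
            (hF n (node (sumLabels ini) ini))

h : Tree → Tree
h t = hF (size t) t

attachRoot : Tree → Tree → Tree
attachRoot (node _ cs) s = node (sumLabels (cs ++ (s ∷ []))) (cs ++ (s ∷ []))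

F0 : Tree → Set
F0 T = T ≡ node 1 []

f1 : Tree → Tree
f1 A = attachRoot A (setLabel 1 (h A))

F1 : Tree → Set
F1 T = Σ Tree λ A → IsBeta A × T ≡ f1 A

-- A₂' : attach h(A₁) below the (b-1)-th node (depth b-2) of the rightmost
-- path of A₂, add 1 to the non-root nodes at depths 1..b-2 of the
-- rightmost path, set the attached root's label to 1, root label to b.
-- (graft also increments the root label, which is then overwritten by b.)
a2' : Tree → ℕ → Tree → Tree
a2' A₁ b A₂ = setLabel b (graft (b ∸ 2) (setLabel 1 (h A₁)) A₂)

f2 : Tree → ℕ → Tree → Tree
f2 A₁ b A₂ = attachRoot A₁ (a2' A₁ b A₂)

F2 : Tree → Set
F2 T = Σ Tree λ A₁ → Σ ℕ λ b → Σ Tree λ A₂ →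
       IsBeta A₁ × 1 < b × IsBeta A₂ × 2 ≤ size A₂ × h A₂ ≡ A₂ ×
       b ∸ 1 ≤ root A₂ × T ≡ f2 A₁ b A₂

module Submission where

-- Write  tree F  for the β(1,0)-tree whose root has the forest F
-- as children, and  ĥ F  for the children of the root of  h (tree F).  Every
-- valid forest is either empty or of the form  K ∷ʳ node (suc m) G, and the
-- recursion (ii)/(iii) defining h computes (lemma h-snoc)
--     ĥ (K ∷ʳ node (suc m) G) = graftForest m (node 1 (ĥ K)) (ĥ G),
-- where  graftForest d s L  attaches s at depth d of the rightmost path of L.
-- By strong induction this yields the basic invariants of ĥ (behaved):
-- h (tree F) = tree (ĥ F), rpath (ĥ F) = root (tree F), and ĥ F is valid.
-- Conversely h turns a graft back into a snoc (h-graft):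
--     ĥ (graftForest d (node 1 W) K) = ĥ W ∷ʳ node (suc d) (ĥ K),
-- and combining the two gives that ĥ is an involution on valid forests.
-- The trees of shapes (F1) and (F2) are exactly grafts
-- graftForest d (node 1 (ĥ F)) K (with d = 0 resp. d = b - 1), so h-graft and
-- the involution show that h fixes them; (F0) is immediate.

open import Defs
open import Function using (_∘_)
open import Data.Empty using (⊥-elim)
open import Data.Nat using (ℕ; zero; suc; _+_; _∸_; _≤_; _<_; z≤n; s≤s)
open import Data.Nat.Properties
  using (≤-refl; ≤-reflexive; ≤-trans; ≤-pred; <⇒≤; n≤1+n; n≮0; m≤m+n; m≤n+m; m<m+n;
         +-identityʳ; +-suc; +-comm; +-assoc; +-monoˡ-≤; +-monoʳ-≤)
open import Data.List using (List; []; _∷_; _∷ʳ_; initLast; _∷ʳ′_)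
open import Data.List.Relation.Unary.All using (All; []; _∷_)
open import Data.List.Relation.Unary.All.Properties using (∷ʳ⁺; ∷ʳ⁻)
open import Data.Product using (_×_; _,_; proj₁; proj₂)
open import Data.Sum using (_⊎_; inj₁; inj₂)
open import Relation.Binary.PropositionalEquality
  using (_≡_; refl; sym; trans; cong; cong₂; subst; module ≡-Reasoning)
open ≡-Reasoning

kids : Tree → List Tree
kids (node _ cs) = cs

tree : List Tree → Tree
tree F = node (sumLabels F) F

ĥ : List Tree → List Tree
ĥ F = kids (h (tree F))

Normal : List Tree → Set
Normal F = h (tree F) ≡ tree (ĥ F)

normal-of : ∀ {F X} → h (tree F) ≡ tree X → Normal F
normal-of e = trans e (cong tree (sym (cong kids e)))

Valid : List Tree → Set
Valid = All NonRootOK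

setLabel-one : ∀ t → setLabel 1 t ≡ node 1 (kids t)
setLabel-one (node _ _) = refl

rpath : Tree → ℕ
rpathList : List Tree → ℕ
rpath (node _ cs) = rpathList cs
rpathList [] = 0
rpathList (t ∷ []) = suc (rpath t)
rpathList (t ∷ ts@(_ ∷ _)) = rpathList ts

rpathList-∷ʳ : ∀ K x → rpathList (K ∷ʳ x) ≡ suc (rpath x)
rpathList-∷ʳ [] x = refl
rpathList-∷ʳ (k ∷ []) x = refl
rpathList-∷ʳ (k ∷ k₂ ∷ K) x = rpathList-∷ʳ (k₂ ∷ K) x

descend : ∀ {n} K l G → suc n ≤ rpathList (K ∷ʳ node l G) → n ≤ rpathList G
descend {n} K l G le = ≤-pred (subst (suc n ≤_) (rpathList-∷ʳ K (node l G)) le)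

sumLabels-∷ʳ : ∀ K x → sumLabels (K ∷ʳ x) ≡ sumLabels K + label x
sumLabels-∷ʳ [] x = +-identityʳ (label x)
sumLabels-∷ʳ (k ∷ K) x =
  trans (cong (label k +_) (sumLabels-∷ʳ K x)) (sym (+-assoc (label k) _ _))

sizeList-∷ʳ : ∀ K x → sizeList (K ∷ʳ x) ≡ sizeList K + size x
sizeList-∷ʳ [] x = +-identityʳ (size x)
sizeList-∷ʳ (k ∷ K) x =
  trans (cong (size k +_) (sizeList-∷ʳ K x)) (sym (+-assoc (size k) _ _))

size-pos : ∀ t → 1 ≤ size t
size-pos (node _ _) = s≤s z≤n

-- The bounds 1 ≤ l ≤ sum of the children already exclude a leaf.
inner : ∀ {l G} → 1 ≤ l → l ≤ sumLabels G → Valid G → NonRootOK (node l G)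
inner {G = []} (s≤s _) ()
inner {G = _ ∷ _} p q v = innerOK p q v

kids-valid : ∀ {l G} → NonRootOK (node l G) → Valid G
kids-valid leafOK = []
kids-valid (innerOK _ _ v) = v

nonRoot-bound : ∀ {m G} → NonRootOK (node (suc m) G) → m ≤ sumLabels G
nonRoot-bound leafOK = z≤n
nonRoot-bound (innerOK _ q _) = ≤-trans (n≤1+n _) q

root-one-valid : ∀ {F} → Valid F → NonRootOK (node 1 F)
root-one-valid [] = leafOK
root-one-valid (leafOK ∷ v) = innerOK ≤-refl (s≤s z≤n) (leafOK ∷ v)
root-one-valid (innerOK p q a ∷ v) =
  innerOK ≤-refl (≤-trans p (m≤m+n _ _)) (innerOK p q a ∷ v)

data ValidSnoc : List Tree → Set where
  []   : ValidSnoc []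
  snoc : ∀ K m G → Valid K → NonRootOK (node (suc m) G) →
         ValidSnoc (K ∷ʳ node (suc m) G)

validSnoc : ∀ F → Valid F → ValidSnoc F
validSnoc F v with initLast F
... | [] = []
... | K ∷ʳ′ x with ∷ʳ⁻ v
...   | vK , leafOK = snoc K 0 [] vK leafOK
...   | vK , innerOK {suc m} p q vG = snoc K m _ vK (innerOK p q vG)

valid-ind : (P : List Tree → Set) → P [] →
            (∀ K m G → Valid K → NonRootOK (node (suc m) G) →
               P K → P G → P (K ∷ʳ node (suc m) G)) →
            ∀ F → Valid F → P F
valid-ind P base step F = go (suc (sizeList F)) F ≤-refl
  where
  smaller : ∀ K l G → sizeList K < sizeList (K ∷ʳ node l G) ×
                      sizeList G < sizeList (K ∷ʳ node l G)
  smaller K l G rewrite sizeList-∷ʳ K (node l G) =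
    m<m+n (sizeList K) (s≤s z≤n) , m≤n+m (suc (sizeList G)) (sizeList K)

  go : ∀ n F → sizeList F < n → Valid F → P F
  go (suc n) F (s≤s le) v with validSnoc F v
  ... | [] = base
  ... | snoc K m G vK x =
    step K m G vK x (go n K (≤-trans K< le) vK) (go n G (≤-trans G< le) (kids-valid x))
    where
    K< : sizeList K < sizeList (K ∷ʳ node (suc m) G)
    K< = proj₁ (smaller K (suc m) G)
    G< : sizeList G < sizeList (K ∷ʳ node (suc m) G)
    G< = proj₂ (smaller K (suc m) G)

-- Unfolding h.  The fuel in hF is irrelevant once it is at least the size of
-- the tree, which turns the clauses of hF into equations for h.

splitLast-∷ʳ : ∀ k K x → splitLast k (K ∷ʳ x) ≡ (k ∷ K , x)
splitLast-∷ʳ k [] x = refl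
splitLast-∷ʳ k (k₂ ∷ K) x rewrite splitLast-∷ʳ k₂ K x = refl

splitLast-size : ∀ x xs →
  sizeList (x ∷ xs) ≡ sizeList (proj₁ (splitLast x xs)) + size (proj₂ (splitLast x xs))
splitLast-size x [] = +-comm (size x) 0
splitLast-size x (y ∷ ys) =
  trans (cong (size x +_) (splitLast-size y ys)) (sym (+-assoc (size x) _ _))

splitCase : ℕ → List Tree × Tree → Tree
splitCase n (ini , lst) =
  replaceRL (hF n (node (label lst) (lst ∷ []))) (hF n (tree ini))

hF-split : ∀ n l x y ys →
  hF (suc n) (node l (x ∷ y ∷ ys)) ≡ splitCase n (splitLast x (y ∷ ys))
hF-split n l (node a []) y ys = refl
hF-split n l (node a (c ∷ cs)) y ys = refl

split-smaller : ∀ x y ys → let S = splitLast x (y ∷ ys) in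
  size (node (label (proj₂ S)) (proj₂ S ∷ [])) ≤ sizeList (x ∷ y ∷ ys) ×
  size (tree (proj₁ S)) ≤ sizeList (x ∷ y ∷ ys)
split-smaller x y ys =
  ≤-trans last≤ (≤-reflexive (sym whole)) , ≤-trans init≤ (≤-reflexive (sym whole))
  where
  ini : List Tree
  ini = proj₁ (splitLast x (y ∷ ys))
  lst : Tree
  lst = proj₂ (splitLast x (y ∷ ys))
  whole : sizeList (x ∷ y ∷ ys) ≡ sizeList ini + size lst
  whole = splitLast-size x (y ∷ ys)
  last≤ : suc (size lst + 0) ≤ sizeList ini + size lst
  last≤ rewrite +-identityʳ (size lst) =
    +-monoˡ-≤ (size lst) (≤-trans (size-pos x) (m≤m+n _ _))
  init≤ : suc (sizeList ini) ≤ sizeList ini + size lst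
  init≤ = subst (_≤ sizeList ini + size lst) (+-comm (sizeList ini) 1)
                (+-monoʳ-≤ (sizeList ini) (size-pos lst))

hF-fuel : ∀ m n t → size t ≤ m → size t ≤ n → hF m t ≡ hF n t
hF-fuel (suc m) (suc n) (node l []) _ _ = refl
hF-fuel (suc m) (suc n) (node l (node a [] ∷ [])) _ _ = refl
hF-fuel (suc m) (suc n) (node l (node c (d ∷ ds) ∷ [])) (s≤s p) (s≤s q) =
  cong (graft (c ∸ 1) leaf) (hF-fuel m n _ (drop p) (drop q))
  where
  drop : ∀ {k} → size (node c (d ∷ ds)) + 0 ≤ k → size (tree (d ∷ ds)) ≤ k
  drop = ≤-trans (≤-reflexive (sym (+-identityʳ _)))
hF-fuel (suc m) (suc n) (node l (x ∷ y ∷ ys)) (s≤s p) (s≤s q) = begin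
  hF (suc m) (node l (x ∷ y ∷ ys))  ≡⟨ hF-split m l x y ys ⟩
  splitCase m (splitLast x (y ∷ ys))
    ≡⟨ cong₂ replaceRL (hF-fuel m n _ (≤-trans last≤ p) (≤-trans last≤ q))
                       (hF-fuel m n _ (≤-trans init≤ p) (≤-trans init≤ q)) ⟩
  splitCase n (splitLast x (y ∷ ys))  ≡⟨ sym (hF-split n l x y ys) ⟩
  hF (suc n) (node l (x ∷ y ∷ ys))  ∎
  where
  S : List Tree × Tree
  S = splitLast x (y ∷ ys)
  last≤ : size (node (label (proj₂ S)) (proj₂ S ∷ [])) ≤ sizeList (x ∷ y ∷ ys)
  last≤ = proj₁ (split-smaller x y ys)
  init≤ : size (tree (proj₁ S)) ≤ sizeList (x ∷ y ∷ ys)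
  init≤ = proj₂ (split-smaller x y ys)

h-fuel : ∀ n t → size t ≤ n → hF n t ≡ h t
h-fuel n t le = hF-fuel n (size t) t le ≤-refl

h-oneChild : ∀ l c g gs →
  h (node l (node c (g ∷ gs) ∷ [])) ≡ graft (c ∸ 1) leaf (h (tree (g ∷ gs)))
h-oneChild l c g gs =
  cong (λ n → graft (c ∸ 1) leaf (hF n (tree (g ∷ gs)))) (+-identityʳ (size (node c (g ∷ gs))))

lastSplit : List Tree × Tree → Tree
lastSplit (ini , lst) = replaceRL (h (tree (lst ∷ []))) (h (tree ini))

h-two : ∀ l x y ys → h (node l (x ∷ y ∷ ys)) ≡ lastSplit (splitLast x (y ∷ ys))
h-two l x y ys =
  trans (hF-split n l x y ys)
        (cong₂ replaceRL (trans (h-fuel n _ (proj₁ (split-smaller x y ys))) relabel)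
                         (h-fuel n _ (proj₂ (split-smaller x y ys))))
  where
  n : ℕ
  n = sizeList (x ∷ y ∷ ys)
  lst : Tree
  lst = proj₂ (splitLast x (y ∷ ys))
  relabel : h (node (label lst) (lst ∷ [])) ≡ h (tree (lst ∷ []))
  relabel = cong (λ a → h (node a (lst ∷ []))) (sym (+-identityʳ (label lst)))

h-split : ∀ l k K x →
  h (node l (k ∷ K ∷ʳ x)) ≡ replaceRL (h (tree (x ∷ []))) (h (tree (k ∷ K)))
h-split l k [] x = h-two l k x []
h-split l k (k₂ ∷ K) x =
  trans (h-two l k k₂ (K ∷ʳ x)) (cong lastSplit (splitLast-∷ʳ k (k₂ ∷ K) x))

-- graftForest d s F attaches s at depth d of the rightmost path below a root
-- with children F (depth 0: s becomes the new last child), adding 1 to the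
-- labels of the path nodes strictly below the root.
graftForest : ℕ → Tree → List Tree → List Tree
graftForest zero s F = F ∷ʳ s
graftForest (suc d) s F = graftLast d s F

graft-node : ∀ d s l F → graft d s (node l F) ≡ node (suc l) (graftForest d s F)
graft-node zero s l F = refl
graft-node (suc d) s l F = refl

graftLast-∷ʳ : ∀ d s K x → graftLast d s (K ∷ʳ x) ≡ K ∷ʳ graft d s x
graftLast-∷ʳ d s [] x = refl
graftLast-∷ʳ d s (k ∷ []) x = refl
graftLast-∷ʳ d s (k ∷ k₂ ∷ K) x = cong (k ∷_) (graftLast-∷ʳ d s (k₂ ∷ K) x)

graftForest-suc : ∀ d s K l G →
  graftForest (suc d) s (K ∷ʳ node l G) ≡ K ∷ʳ node (suc l) (graftForest d s G)
graftForest-suc d s K l G =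
  trans (graftLast-∷ʳ d s K (node l G)) (cong (K ∷ʳ_) (graft-node d s l G))

graftForest-rpath : ∀ d s K → d ≤ rpathList K →
  rpathList (graftForest d s K) ≡ suc (d + rpath s)
graftForest-rpath zero s K _ = rpathList-∷ʳ K s
graftForest-rpath (suc d) s K le with initLast K
graftForest-rpath (suc d) s _ () | []
graftForest-rpath (suc d) s _ le | K ∷ʳ′ node l G =
  trans (cong rpathList (graftForest-suc d s K l G))
  (trans (rpathList-∷ʳ K _) (cong suc (graftForest-rpath d s G (descend K l G le))))

graftForest-sum : ∀ d W K → d ≤ rpathList K →
  sumLabels (graftForest d (node 1 W) K) ≡ suc (sumLabels K)
graftForest-sum zero W K _ = trans (sumLabels-∷ʳ K (node 1 W)) (+-comm (sumLabels K) 1)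
graftForest-sum (suc d) W K le with initLast K
graftForest-sum (suc d) W _ () | []
graftForest-sum (suc d) W _ le | K ∷ʳ′ node l G = begin
  sumLabels (graftForest (suc d) (node 1 W) (K ∷ʳ node l G))
    ≡⟨ cong sumLabels (graftForest-suc d (node 1 W) K l G) ⟩
  sumLabels (K ∷ʳ node (suc l) (graftForest d (node 1 W) G))
    ≡⟨ sumLabels-∷ʳ K _ ⟩
  sumLabels K + suc l  ≡⟨ +-suc (sumLabels K) l ⟩
  suc (sumLabels K + l)  ≡⟨ cong suc (sym (sumLabels-∷ʳ K (node l G))) ⟩
  suc (sumLabels (K ∷ʳ node l G))  ∎

graftForest-valid : ∀ d W K → Valid W → Valid K → d < rpathList K →
  Valid (graftForest d (node 1 W) K)
graftForest-valid zero W K vW vK _ = ∷ʳ⁺ vK (root-one-valid vW)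
graftForest-valid (suc d) W K vW vK lt with validSnoc K vK
graftForest-valid (suc d) W _ vW vK () | []
graftForest-valid (suc d) W _ vW vK lt | snoc K m [] _ _ =
  ⊥-elim (n≮0 (descend K (suc m) [] lt))
graftForest-valid (suc d) W _ vW vK lt | snoc K m (c ∷ cs) vK' (innerOK _ q vG) =
  subst Valid (sym (graftForest-suc d (node 1 W) K (suc m) (c ∷ cs)))
    (∷ʳ⁺ vK' (inner (s≤s z≤n) bound (graftForest-valid d W (c ∷ cs) vW vG lt')))
  where
  lt' : d < rpathList (c ∷ cs)
  lt' = descend K (suc m) (c ∷ cs) lt
  bound : suc (suc m) ≤ sumLabels (graftForest d (node 1 W) (c ∷ cs))
  bound = subst (suc (suc m) ≤_) (sym (graftForest-sum d W (c ∷ cs) (<⇒≤ lt'))) (s≤s q)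

replaceRLList-∷ʳ : ∀ K y Z → replaceRLList (K ∷ʳ y) Z ≡ K ∷ʳ replaceRL y Z
replaceRLList-∷ʳ [] y Z = refl
replaceRLList-∷ʳ (k ∷ []) y Z = refl
replaceRLList-∷ʳ (k ∷ k₂ ∷ K) y Z = cong (k ∷_) (replaceRLList-∷ʳ (k₂ ∷ K) y Z)

replaceRL-∷ʳ : ∀ l K y Z → replaceRL (node l (K ∷ʳ y)) Z ≡ node l (K ∷ʳ replaceRL y Z)
replaceRL-∷ʳ l [] y Z = refl
replaceRL-∷ʳ l (k ∷ K) y Z = cong (node l) (replaceRLList-∷ʳ (k ∷ K) y Z)

-- The leaf grafted at depth d is the rightmost leaf, so identifying it with Z
-- is the same as grafting Z (relabelled 1) at depth d.
replaceRL-graft : ∀ d l K Z → d ≤ rpathList K →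
  replaceRL (node l (graftForest d leaf K)) Z ≡ node l (graftForest d (setLabel 1 Z) K)
replaceRL-graft zero l K Z _ = replaceRL-∷ʳ l K leaf Z
replaceRL-graft (suc d) l K Z le with initLast K
replaceRL-graft (suc d) l _ Z () | []
replaceRL-graft (suc d) l _ Z le | K ∷ʳ′ node a G = begin
  replaceRL (node l (graftForest (suc d) leaf (K ∷ʳ node a G))) Z
    ≡⟨ cong (λ L → replaceRL (node l L) Z) (graftForest-suc d leaf K a G) ⟩
  replaceRL (node l (K ∷ʳ node (suc a) (graftForest d leaf G))) Z
    ≡⟨ replaceRL-∷ʳ l K _ Z ⟩
  node l (K ∷ʳ replaceRL (node (suc a) (graftForest d leaf G)) Z)
    ≡⟨ cong (λ t → node l (K ∷ʳ t)) (replaceRL-graft d (suc a) G Z (descend K a G le)) ⟩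
  node l (K ∷ʳ node (suc a) (graftForest d (setLabel 1 Z) G))
    ≡⟨ cong (node l) (sym (graftForest-suc d (setLabel 1 Z) K a G)) ⟩
  node l (graftForest (suc d) (setLabel 1 Z) (K ∷ʳ node a G))  ∎

-- h maps a forest ending with a tree to a graft.

h-single : ∀ m G → Normal G → m ≤ rpathList (ĥ G) →
  h (tree (node (suc m) G ∷ [])) ≡ tree (graftForest m leaf (ĥ G))
h-single zero [] _ _ = refl
h-single (suc m) [] _ ()
h-single m (g ∷ gs) nG le = begin
  h (tree (node (suc m) (g ∷ gs) ∷ []))  ≡⟨ h-oneChild (suc m + 0) (suc m) g gs ⟩
  graft m leaf (h (tree (g ∷ gs)))  ≡⟨ cong (graft m leaf) nG ⟩
  graft m leaf (tree (ĥ (g ∷ gs)))  ≡⟨ graft-node m leaf _ (ĥ (g ∷ gs)) ⟩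
  node (suc (sumLabels (ĥ (g ∷ gs)))) (graftForest m leaf (ĥ (g ∷ gs)))
    ≡⟨ cong (λ n → node n (graftForest m leaf (ĥ (g ∷ gs))))
            (sym (graftForest-sum m [] (ĥ (g ∷ gs)) le)) ⟩
  tree (graftForest m leaf (ĥ (g ∷ gs)))  ∎

-- The central computation: case (iii) identifies the rightmost leaf of the
-- graft above with the root of h (tree K), i.e. grafts node 1 (ĥ K) instead.
h-snoc : ∀ K m G → Normal K → Normal G → m ≤ rpathList (ĥ G) →
  h (tree (K ∷ʳ node (suc m) G)) ≡ tree (graftForest m (node 1 (ĥ K)) (ĥ G))
h-snoc [] m G _ nG le = h-single m G nG le
h-snoc (k ∷ K) m G nK nG le = begin
  h (tree (k ∷ K ∷ʳ node (suc m) G))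
    ≡⟨ h-split _ k K (node (suc m) G) ⟩
  replaceRL (h (tree (node (suc m) G ∷ []))) (h (tree (k ∷ K)))
    ≡⟨ cong₂ replaceRL (h-single m G nG le) nK ⟩
  replaceRL (tree (graftForest m leaf (ĥ G))) (tree (ĥ (k ∷ K)))
    ≡⟨ replaceRL-graft m _ (ĥ G) _ le ⟩
  node (sumLabels (graftForest m leaf (ĥ G))) (graftForest m (node 1 (ĥ (k ∷ K))) (ĥ G))
    ≡⟨ cong (λ n → node n (graftForest m (node 1 (ĥ (k ∷ K))) (ĥ G)))
            (trans (graftForest-sum m [] (ĥ G) le)
                   (sym (graftForest-sum m (ĥ (k ∷ K)) (ĥ G) le))) ⟩
  tree (graftForest m (node 1 (ĥ (k ∷ K))) (ĥ G))  ∎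

record Behaved (F : List Tree) : Set where
  field
    isNormal : Normal F
    rpathEq  : rpathList (ĥ F) ≡ sumLabels F
    validĥ   : Valid (ĥ F)
open Behaved

behaved : ∀ F → Valid F → Behaved F
behaved = valid-ind Behaved (record { isNormal = refl ; rpathEq = refl ; validĥ = [] }) step
  where
  step : ∀ K m G → Valid K → NonRootOK (node (suc m) G) →
         Behaved K → Behaved G → Behaved (K ∷ʳ node (suc m) G)
  step K m G vK x bK bG = record
    { isNormal = normal-of {K ∷ʳ node (suc m) G} eq
    ; rpathEq  = begin
        rpathList (ĥ (K ∷ʳ node (suc m) G))  ≡⟨ cong rpathList ĥF ⟩
        rpathList (graftForest m (node 1 (ĥ K)) (ĥ G))  ≡⟨ graftForest-rpath m _ (ĥ G) le ⟩
        suc (m + rpathList (ĥ K))  ≡⟨ cong (λ r → suc (m + r)) (rpathEq bK) ⟩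
        suc m + sumLabels K  ≡⟨ +-comm (suc m) (sumLabels K) ⟩
        sumLabels K + suc m  ≡⟨ sym (sumLabels-∷ʳ K (node (suc m) G)) ⟩
        sumLabels (K ∷ʳ node (suc m) G)  ∎
    ; validĥ   = subst Valid (sym ĥF) (graft-valid x bG)
    }
    where
    le : m ≤ rpathList (ĥ G)
    le = subst (m ≤_) (sym (rpathEq bG)) (nonRoot-bound x)
    eq : h (tree (K ∷ʳ node (suc m) G)) ≡ tree (graftForest m (node 1 (ĥ K)) (ĥ G))
    eq = h-snoc K m G (isNormal bK) (isNormal bG) le
    ĥF : ĥ (K ∷ʳ node (suc m) G) ≡ graftForest m (node 1 (ĥ K)) (ĥ G)
    ĥF = cong kids eq
    graft-valid : ∀ {m G} → NonRootOK (node (suc m) G) → Behaved G →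
                  Valid (graftForest m (node 1 (ĥ K)) (ĥ G))
    graft-valid leafOK _ = root-one-valid (validĥ bK) ∷ []
    graft-valid {m} {G} (innerOK _ q _) b =
      graftForest-valid m (ĥ K) (ĥ G) (validĥ bK) (validĥ b)
        (subst (m <_) (sym (rpathEq b)) q)

h-normal : ∀ {F} → Valid F → Normal F
h-normal {F} v = isNormal (behaved F v)

ĥ-rpath : ∀ {F} → Valid F → rpathList (ĥ F) ≡ sumLabels F
ĥ-rpath {F} v = rpathEq (behaved F v)

ĥ-valid : ∀ {F} → Valid F → Valid (ĥ F)
ĥ-valid {F} v = validĥ (behaved F v)

graft-depth : ∀ {m G} → NonRootOK (node (suc m) G) → m ≤ rpathList (ĥ G)
graft-depth {m} x = subst (m ≤_) (sym (ĥ-rpath (kids-valid x))) (nonRoot-bound x)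

ĥ-snoc : ∀ K m G → Valid K → NonRootOK (node (suc m) G) →
  ĥ (K ∷ʳ node (suc m) G) ≡ graftForest m (node 1 (ĥ K)) (ĥ G)
ĥ-snoc K m G vK x =
  cong kids (h-snoc K m G (h-normal vK) (h-normal (kids-valid x)) (graft-depth x))

-- h maps a graft back to a forest ending with a tree.

h-graft : ∀ d W K → Normal W → Valid K → d ≤ rpathList K →
  h (tree (graftForest d (node 1 W) K)) ≡ tree (ĥ W ∷ʳ node (suc d) (ĥ K))
h-graft zero W K nW vK _ = h-snoc K 0 W (h-normal vK) nW z≤n
h-graft (suc d) W K nW vK le with validSnoc K vK
h-graft (suc d) W _ nW vK () | []
h-graft (suc d) W _ nW vK le | snoc K m G vK' x = begin
  h (tree (graftForest (suc d) s (K ∷ʳ node (suc m) G)))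
    ≡⟨ cong (h ∘ tree) (graftForest-suc d s K (suc m) G) ⟩
  h (tree (K ∷ʳ node (suc (suc m)) G'))
    ≡⟨ h-snoc K (suc m) G' (h-normal vK') (normal-of {G'} IH) depth ⟩
  tree (graftForest (suc m) (node 1 (ĥ K)) (ĥ G'))
    ≡⟨ cong (tree ∘ graftForest (suc m) (node 1 (ĥ K))) ĥG' ⟩
  tree (graftForest (suc m) (node 1 (ĥ K)) (ĥ W ∷ʳ node (suc d) (ĥ G)))
    ≡⟨ cong tree (graftForest-suc m (node 1 (ĥ K)) (ĥ W) (suc d) (ĥ G)) ⟩
  tree (ĥ W ∷ʳ node (suc (suc d)) (graftForest m (node 1 (ĥ K)) (ĥ G)))
    ≡⟨ cong (λ L → tree (ĥ W ∷ʳ node (suc (suc d)) L)) (sym (ĥ-snoc K m G vK' x)) ⟩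
  tree (ĥ W ∷ʳ node (suc (suc d)) (ĥ (K ∷ʳ node (suc m) G)))  ∎
  where
  s : Tree
  s = node 1 W
  G' : List Tree
  G' = graftForest d s G
  IH : h (tree G') ≡ tree (ĥ W ∷ʳ node (suc d) (ĥ G))
  IH = h-graft d W G nW (kids-valid x) (descend K (suc m) G le)
  ĥG' : ĥ G' ≡ ĥ W ∷ʳ node (suc d) (ĥ G)
  ĥG' = cong kids IH
  depth : suc m ≤ rpathList (ĥ G')
  depth = subst (suc m ≤_)
            (sym (trans (cong rpathList ĥG') (rpathList-∷ʳ (ĥ W) (node (suc d) (ĥ G)))))
            (s≤s (graft-depth x))

ĥ-involutive : ∀ F → Valid F → ĥ (ĥ F) ≡ F
ĥ-involutive = valid-ind (λ F → ĥ (ĥ F) ≡ F) refl step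
  where
  step : ∀ K m G → Valid K → NonRootOK (node (suc m) G) →
         ĥ (ĥ K) ≡ K → ĥ (ĥ G) ≡ G → ĥ (ĥ (K ∷ʳ node (suc m) G)) ≡ K ∷ʳ node (suc m) G
  step K m G vK x ihK ihG = begin
    ĥ (ĥ (K ∷ʳ node (suc m) G))  ≡⟨ cong ĥ (ĥ-snoc K m G vK x) ⟩
    ĥ (graftForest m (node 1 (ĥ K)) (ĥ G))
      ≡⟨ cong kids (h-graft m (ĥ K) (ĥ G) (h-normal (ĥ-valid vK))
                            (ĥ-valid (kids-valid x)) (graft-depth x)) ⟩
    ĥ (ĥ K) ∷ʳ node (suc m) (ĥ (ĥ G))  ≡⟨ cong₂ (λ A B → A ∷ʳ node (suc m) B) ihK ihG ⟩
    K ∷ʳ node (suc m) G  ∎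

h-graft-ĥ : ∀ d F K → Valid F → Valid K → d ≤ rpathList K →
  h (tree (graftForest d (node 1 (ĥ F)) K)) ≡ tree (F ∷ʳ node (suc d) (ĥ K))
h-graft-ĥ d F K vF vK le =
  trans (h-graft d (ĥ F) K (h-normal (ĥ-valid vF)) vK le)
        (cong (λ L → tree (L ∷ʳ node (suc d) (ĥ K))) (ĥ-involutive F vF))

beta-valid : ∀ {l F} → IsBeta (node l F) → Valid F
beta-valid single = []
beta-valid (rootOK _ v) = v

beta-h : ∀ {l F} → IsBeta (node l F) → setLabel 1 (h (node l F)) ≡ node 1 (ĥ F)
beta-h single = refl
beta-h (rootOK {c = c} {cs = cs} refl _) = setLabel-one (h (tree (c ∷ cs)))

-- (F1): f1 A is the graft of node 1 (ĥ F) at depth 0 into the children F of A.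
f1-fixed : ∀ A → IsBeta A → h (f1 A) ≡ f1 A
f1-fixed (node l F) β =
  subst (λ s → h (tree (F ∷ʳ s)) ≡ tree (F ∷ʳ s)) (sym (beta-h β))
        (h-graft-ĥ 0 F F vF vF z≤n)
  where
  vF : Valid F
  vF = beta-valid β

-- (F2): with A₁ = node l F, A₂ = tree K₂ and b = suc (suc d), f2 A₁ b A₂ is the
-- graft of node 1 (ĥ F) at depth suc d into F ∷ʳ node (suc d) K₂.
f2-fixed : ∀ A₁ b A₂ → IsBeta A₁ → 1 < b → IsBeta A₂ → 2 ≤ size A₂ → h A₂ ≡ A₂ →
           b ∸ 1 ≤ root A₂ → h (f2 A₁ b A₂) ≡ f2 A₁ b A₂
f2-fixed _ _ _ _ _ single (s≤s ()) _ _
f2-fixed (node l F) (suc (suc d)) _ β₁ (s≤s (s≤s z≤n)) (rootOK {c = c} {cs = cs} refl v₂) _ hA₂ bound =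
  subst (λ t → h (tree (F ∷ʳ t)) ≡ tree (F ∷ʳ t)) (sym A₂'-shape) (begin
    h (tree (F ∷ʳ node (suc (suc d)) (graftForest d s K₂)))
      ≡⟨ cong (h ∘ tree) (sym (graftForest-suc d s F (suc d) K₂)) ⟩
    h (tree (graftForest (suc d) s (F ∷ʳ node (suc d) K₂)))
      ≡⟨ h-graft-ĥ (suc d) F (F ∷ʳ node (suc d) K₂) vF (∷ʳ⁺ vF x₂) depth ⟩
    tree (F ∷ʳ node (suc (suc d)) (ĥ (F ∷ʳ node (suc d) K₂)))
      ≡⟨ cong (λ L → tree (F ∷ʳ node (suc (suc d)) L))
              (trans (ĥ-snoc F d K₂ vF x₂) (cong (graftForest d s) ĥK₂)) ⟩
    tree (F ∷ʳ node (suc (suc d)) (graftForest d s K₂))  ∎)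
  where
  K₂ : List Tree
  K₂ = c ∷ cs
  vF : Valid F
  vF = beta-valid β₁
  s : Tree
  s = node 1 (ĥ F)
  ĥK₂ : ĥ K₂ ≡ K₂
  ĥK₂ = cong kids hA₂
  x₂ : NonRootOK (node (suc d) K₂)
  x₂ = inner (s≤s z≤n) bound v₂
  depth : suc d ≤ rpathList (F ∷ʳ node (suc d) K₂)
  depth = subst (suc d ≤_) (sym (rpathList-∷ʳ F (node (suc d) K₂)))
            (s≤s (subst (d ≤_) (trans (sym (ĥ-rpath v₂)) (cong rpathList ĥK₂))
                        (≤-trans (n≤1+n d) bound)))
  A₂'-shape : a2' (node l F) (suc (suc d)) (tree K₂) ≡ node (suc (suc d)) (graftForest d s K₂)
  A₂'-shape = cong (setLabel (suc (suc d)))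
    (trans (cong (λ t → graft d t (tree K₂)) (beta-h β₁)) (graft-node d s (sumLabels K₂) K₂))

lemma2 : (T : Tree) → IsBeta T → F0 T ⊎ F1 T ⊎ F2 T → h T ≡ T
lemma2 T _ (inj₁ refl) = refl
lemma2 T _ (inj₂ (inj₁ (A , βA , refl))) = f1-fixed A βA
lemma2 T _ (inj₂ (inj₂ (A₁ , b , A₂ , βA₁ , 1<b , βA₂ , 2≤|A₂| , hA₂ , b-1≤root , refl))) =
  f2-fixed A₁ b A₂ βA₁ 1<b βA₂ 2≤|A₂| hA₂ b-1≤root
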